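{- Let $N$ be a homogeneous network with asymmetric inputs having only one edge type. Let $l$ be the least common multiple of the sizes of all rings of $N$ and $p$ the depth of $N$. Then the fundamental network of $N$ is a loop-chain with size $l$ and $p$.
   Context: A homogeneous network with asymmetric inputs and one edge type has a finite cell set $C$ and is represented by a single function $\sigma:C\to C$: each cell $c$ receives exactly one edge, from $\sigma(c)$. Its fundamental network has as cells the semigroup $\tilde{C}$ of maps $C\to C$ generated under composition by $Id_C$ and $\sigma$ (i.e. $\{Id_C,\sigma,\sigma^2,\dots\}$), and is represented by $\tilde{\sigma}(\gamma)=\sigma\circ\gamma$. Each connected component (maximal set of cells pairwise joined by undirected paths) contains a unique source (a maximal strongly connected set of cells receiving no edge from outside it), called its ring. For $r,c$ in a component, $|(r,c)|$ is $0$ if $r=c$ and otherwise the length of a shortest directed path from $r$ to $c$; the depth of a component is $\max_c\min_{r\in\text{ring}}|(r,c)|$, and the depth of the network is the maximum over components. A loop-chain with size $l\ge1$ and $p\ge0$ is a one-edge-type homogeneous network with asymmetric inputs having $l+p$ cells, a unique source component with $l$ cells, and depth $p$. Networks are identified up to isomorphism. -}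

module Defs where

open import Data.Nat using (ℕ; zero; suc; _+_; _≤_)
open import Data.Nat.Divisibility using (_∣_)
open import Data.Fin using (Fin)
open import Data.Fin.Subset using (Subset; _∈_; _⊆_; ∣_∣)
open import Data.Product using (Σ; ∃; _×_; _,_)
open import Relation.Binary.PropositionalEquality using (_≡_; _≗_)
open import Function using (_∘_; id)

iter : {A : Set} → (A → A) → ℕ → A → A
iter f zero    = id
iter f (suc k) = f ∘ iter f k

-- A homogeneous network with asymmetric inputs and one edge type on the
-- finite cell set Fin m, given by σ : Fin m → Fin m.  Each cell c
-- receives exactly one edge, from σ c.
module Network {m : ℕ} (σ : Fin m → Fin m) where

  -- directed path from r to c of length k  (r = x₀ → x₁ → … → x_k = c,
  -- with an edge x_i → x_{i+1} meaning σ x_{i+1} ≡ x_i)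
  data Path : Fin m → Fin m → ℕ → Set where
    here  : ∀ {c} → Path c c 0
    there : ∀ {r c k} → Path r (σ c) k → Path r c (suc k)

  data Conn : Fin m → Fin m → Set where
    conn-refl : ∀ {c} → Conn c c
    conn-fwd  : ∀ {c d} → Conn c (σ d) → Conn c d
    conn-bwd  : ∀ {c d} → Conn c d → Conn c (σ d)

  StronglyConnected : Subset m → Set
  StronglyConnected S = ∀ a b → a ∈ S → b ∈ S → ∃ λ k → Path a b k

  -- a source: a nonempty maximal strongly connected set of cells
  -- receiving no edge from outside it
  IsSource : Subset m → Set
  IsSource S =
    (∃ λ c → c ∈ S)
    × StronglyConnected S
    × (∀ T → S ⊆ T → StronglyConnected T → T ⊆ S)
    × (∀ c → c ∈ S → σ c ∈ S)

  -- r lies in the ring (source) of the connected component of c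
  InRingOf : Fin m → Fin m → Set
  InRingOf r c = ∃ λ S → IsSource S × r ∈ S × Conn r c

  MinDist : Fin m → ℕ → Set
  MinDist c d =
    (∃ λ r → InRingOf r c × Path r c d)
    × (∀ r k → InRingOf r c → Path r c k → d ≤ k)

  -- p is the depth: the maximum over all cells of MinDist (0 if no cells)
  HasDepth : ℕ → Set
  HasDepth p =
    (∀ c d → MinDist c d → d ≤ p)
    × (∀ q → (∀ c d → MinDist c d → d ≤ q) → p ≤ q)

  IsLcmOfRingSizes : ℕ → Set
  IsLcmOfRingSizes l =
    (∀ S → IsSource S → ∣ S ∣ ∣ l)
    × (∀ k → (∀ S → IsSource S → ∣ S ∣ ∣ k) → l ∣ k)

  IsLoopChain : ℕ → ℕ → Set
  IsLoopChain l p =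
    m ≡ l + p
    × (∃ λ S → IsSource S × ∣ S ∣ ≡ l × (∀ T → IsSource T → T ≡ S))
    × HasDepth p

open Network public

-- (m , τ) presents (up to isomorphism) the fundamental network of σ:
-- e enumerates, without repetition (up to pointwise equality), exactly the
-- maps in {Id, σ, σ², …}, and τ corresponds to γ ↦ σ ∘ γ.
IsFundamentalNetwork : {n : ℕ} → (Fin n → Fin n) → (m : ℕ) → (Fin m → Fin m) → Set
IsFundamentalNetwork {n} σ m τ =
  Σ (Fin m → (Fin n → Fin n)) λ e →
    (∀ i → ∃ λ k → e i ≗ iter σ k)
    × (∀ k → ∃ λ i → e i ≗ iter σ k)
    × (∀ i j → e i ≗ e j → i ≡ j)
    × (∀ i → e (τ i) ≗ σ ∘ e i)

-- The powers of σ form a finite cyclic monoid: there are an index P and a period L with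
-- σᵃ = σᵇ exactly when a = b, or a, b ≥ P and L ∣ b − a. So the fundamental network is
-- σᵏ ↦ σᵏ⁺¹ on the P + L distinct powers: a tail of length P running into one cycle of
-- length L, i.e. a loop-chain with size L and P. A ring is the orbit of any of its cells,
-- so its size is the minimal period of that cell. Since σᴸ fixes every ring cell, and any
-- common multiple of the ring sizes is a period of every σᴾ x, L is the lcm of the ring
-- sizes. Since σᴾ x lies in a ring, the depth p is at most P; conversely every cell reaches
-- a ring within p steps, so σ^(p+L) = σᵖ and P ≤ p.
module Submission where

open import Data.Bool using (true)
open import Data.Empty using (⊥-elim)
open import Data.Fin using (Fin; zero; suc; toℕ; fromℕ<)
open import Data.Fin.Properties
  using (toℕ<n; toℕ-injective; toℕ-fromℕ<; suc-injective; injective⇒≤; pigeonhole; any?; ≡-decSetoid)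
  renaming (_≟_ to _≟ᶠ_)
open import Data.Fin.Subset using (Subset; _∈_; _∉_; _⊆_; ∣_∣; _-_; inside; outside)
open import Data.Fin.Subset.Properties
  using (Empty-unique; ∣⊥∣≡0; p─⊥≡p; p─q⊆p; x∈p∧x≢y⇒x∈p-y; ⊆-antisym)
open import Data.Nat using (ℕ; zero; suc; pred; _+_; _*_; _∸_; _%_; _/_; _!; _≤_; _<_; z≤n; s≤s; s≤s⁻¹; _<?_)
open import Data.Nat.Divisibility
  using (_∣_; divides; ∣⇒≤; ∣-antisym; ∣-trans; m∣m*n; m≤n⇒m!∣n!; m%n≡0⇒n∣m)
open import Data.Nat.DivMod using (m≡m%n+[m/n]*n; m%n<n)
open import Data.Nat.Properties
  using (+-comm; +-assoc; +-suc; +-identityʳ; +-cancelˡ-≡; +-mono-≤; +-monoʳ-<; n<1+n; m≤m+n; m≤n+m; m≤m*n;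
         ≤-refl; ≤-trans; ≤-reflexive; ≤-antisym; <⇒≤; <⇒≱; ≮⇒≥; <-cmp; m∸n+n≡m; m+[n∸m]≡n;
         m≤n⇒∃[o]m+o≡n; suc-pred; _!≢0; +-commutativeSemigroup)
open import Algebra.Properties.CommutativeSemigroup +-commutativeSemigroup using (x∙yz≈y∙xz)
open import Data.Product using (Σ; ∃; _×_; _,_; proj₁; proj₂)
open import Data.Vec using (_∷_; here; there; tabulate)
open import Data.Vec.Properties using (lookup∘tabulate; lookup⇒[]=; []=⇒lookup)
import Data.Vec.Functional.Relation.Binary.Pointwise.Properties as Pointwise
open import Defs
open import Function using (_∘_; case_of_)
open import Function.Definitions using (Injective)
open import Relation.Binary.Bundles using (Setoid; DecSetoid)
open import Relation.Binary.Definitions using (tri<; tri≈; tri>)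
open import Relation.Binary.PropositionalEquality
  using (_≡_; _≗_; refl; sym; trans; cong; subst; subst₂; module ≡-Reasoning)
import Relation.Binary.PropositionalEquality as ≡
open import Relation.Nullary using (Dec; yes; no; does)
open import Relation.Nullary.Decidable using (dec-true)
open import Relation.Unary using (Decidable)

iter-+ : ∀ {A : Set} (f : A → A) a b x → iter f (a + b) x ≡ iter f a (iter f b x)
iter-+ f zero    b x = refl
iter-+ f (suc a) b x = cong f (iter-+ f a b x)

iter-+′ : ∀ {A : Set} (f : A → A) a b x → iter f (a + b) x ≡ iter f b (iter f a x)
iter-+′ f a b x = trans (cong (λ t → iter f t x) (+-comm a b)) (iter-+ f b a x)

iter-commute : ∀ {A : Set} (f : A → A) k x → iter f k (f x) ≡ f (iter f k x)
iter-commute f zero    x = refl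
iter-commute f (suc k) x = cong f (iter-commute f k x)

iter-*-fixed : ∀ {A : Set} (f : A → A) {D y} → iter f D y ≡ y → ∀ t → iter f (t * D) y ≡ y
iter-*-fixed f         fixed zero    = refl
iter-*-fixed f {D} {y} fixed (suc t) = begin
  iter f (D + t * D) y         ≡⟨ iter-+ f D (t * D) y ⟩
  iter f D (iter f (t * D) y)  ≡⟨ cong (iter f D) (iter-*-fixed f fixed t) ⟩
  iter f D y                   ≡⟨ fixed ⟩
  y                            ∎
  where open ≡-Reasoning

orbit-shift : ∀ {A : Set} (f : A → A) {x} k {a b} →
              iter f a x ≡ iter f b x → iter f (k + a) x ≡ iter f (k + b) x
orbit-shift f {x} k {a} {b} eq = begin
  iter f (k + a) x       ≡⟨ iter-+ f k a x ⟩
  iter f k (iter f a x)  ≡⟨ cong (iter f k) eq ⟩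
  iter f k (iter f b x)  ≡⟨ iter-+ f k b x ⟨
  iter f (k + b) x       ∎
  where open ≡-Reasoning

record Least {ℓ} (P : ℕ → Set ℓ) : Set ℓ where
  field
    value   : ℕ
    holds   : P value
    minimal : ∀ {j} → P j → value ≤ j

least : ∀ {ℓ} {P : ℕ → Set ℓ} → Decidable P → ∀ {w} → P w → Least P
least         P? {zero}  p = record { value = 0 ; holds = p ; minimal = λ _ → z≤n }
least {P = P} P? {suc w} p with P? 0
... | yes p₀ = record { value = 0 ; holds = p₀ ; minimal = λ _ → z≤n }
... | no ¬p₀ = record { value = suc value ; holds = holds ; minimal = minimal′ }
  where
    open Least (least (P? ∘ suc) p)
    minimal′ : ∀ {j} → P j → suc value ≤ j
    minimal′ {zero}  p₀ = ⊥-elim (¬p₀ p₀)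
    minimal′ {suc j} pj = s≤s (minimal pj)

module ShiftInvariant {c ℓ} (S : Setoid c ℓ) (s : ℕ → Setoid.Carrier S)
  (shift : ∀ k {a b} → Setoid._≈_ S (s a) (s b) → Setoid._≈_ S (s (k + a)) (s (k + b))) where

  open Setoid S using (_≈_; reflexive)
  open import Relation.Binary.Reasoning.Setoid S

  period-≤ : ∀ {a D x} → s (a + D) ≈ s a → a ≤ x → s (x + D) ≈ s x
  period-≤ {a} {D} {x} p a≤x = begin
    s (x + D)            ≡⟨ cong s (trans (cong (_+ D) (sym (m∸n+n≡m a≤x))) (+-assoc (x ∸ a) a D)) ⟩
    s (x ∸ a + (a + D))  ≈⟨ shift (x ∸ a) p ⟩
    s (x ∸ a + a)        ≡⟨ cong s (m∸n+n≡m a≤x) ⟩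
    s x                  ∎

  period-* : ∀ {a D} → s (a + D) ≈ s a → ∀ t → s (a + t * D) ≈ s a
  period-* {a} {D} p zero    = reflexive (cong s (+-identityʳ a))
  period-* {a} {D} p (suc t) = begin
    s (a + (D + t * D))  ≡⟨ cong s (x∙yz≈y∙xz a D (t * D)) ⟩
    s (D + (a + t * D))  ≈⟨ shift D (period-* p t) ⟩
    s (D + a)            ≡⟨ cong s (+-comm D a) ⟩
    s (a + D)            ≈⟨ p ⟩
    s a                  ∎

module OrbitOf {A : Set} (f : A → A) (x : A) =
  ShiftInvariant (≡.setoid A) (λ t → iter f t x) (orbit-shift f)

module EventuallyPeriodic {c ℓ} (S : DecSetoid c ℓ) (s : ℕ → DecSetoid.Carrier S)
  (shift : ∀ k {a b} → DecSetoid._≈_ S (s a) (s b) → DecSetoid._≈_ S (s (k + a)) (s (k + b)))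
  {a₀ d : ℕ} (repeats : DecSetoid._≈_ S (s (a₀ + suc d)) (s a₀)) where

  open DecSetoid S using (_≈_; _≟_; reflexive; setoid)
    renaming (refl to ≈-refl; sym to ≈-sym; trans to ≈-trans)
  open import Relation.Binary.Reasoning.Setoid setoid
  open ShiftInvariant setoid s shift public

  private
    indexSearch : Least λ a → s (a + suc d) ≈ s a
    indexSearch = least (λ a → s (a + suc d) ≟ s a) repeats

  index : ℕ
  index = Least.value indexSearch

  -- A period e + 1 from a also gives the period d + 1 from a, by moving up to a₀ and back.
  index-least : ∀ {a e} → s (a + suc e) ≈ s a → index ≤ a
  index-least {a} {e} p = Least.minimal indexSearch (begin
    s (a + suc d)                 ≡⟨ cong s (+-comm a (suc d)) ⟩
    s (suc d + a)                 ≈⟨ shift (suc d) (period-* p a₀) ⟨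
    s (suc d + (a + a₀ * suc e))  ≡⟨ cong s (+-comm (suc d) _) ⟩
    s (a + a₀ * suc e + suc d)    ≈⟨ period-≤ repeats (≤-trans (m≤m*n a₀ (suc e)) (m≤n+m _ a)) ⟩
    s (a + a₀ * suc e)            ≈⟨ period-* p a₀ ⟩
    s a                           ∎)

  private
    periodSearch : Least λ e → s (index + suc e) ≈ s index
    periodSearch = least (λ e → s (index + suc e) ≟ s index) (Least.holds indexSearch)

  period : ℕ
  period = suc (Least.value periodSearch)

  period-at-index : s (index + period) ≈ s index
  period-at-index = Least.holds periodSearch

  periodic-from : ∀ {x} → index ≤ x → s (x + period) ≈ s x
  periodic-from = period-≤ period-at-index

  period∣ : ∀ {a D} → index ≤ a → s (a + D) ≈ s a → period ∣ D
  period∣ {a} {D} index≤a p = m%n≡0⇒n∣m D period remainder≡0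
    where
      period-from-index : s (index + D) ≈ s index
      period-from-index = begin
        s (index + D)                 ≡⟨ cong s (+-comm index D) ⟩
        s (D + index)                 ≈⟨ shift D (period-* period-at-index a) ⟨
        s (D + (index + a * period))  ≡⟨ cong s (+-comm D _) ⟩
        s (index + a * period + D)    ≈⟨ period-≤ p (≤-trans (m≤m*n a period) (m≤n+m _ index)) ⟩
        s (index + a * period)        ≈⟨ period-* period-at-index a ⟩
        s index                       ∎

      remainder : s (index + D % period) ≈ s index
      remainder = begin
        s (index + D % period)                        ≈⟨ period-* (periodic-from (m≤m+n index _)) (D / period) ⟨
        s (index + D % period + D / period * period)  ≡⟨ cong s (trans (+-assoc index _ _)
                                                            (cong (index +_) (sym (m≡m%n+[m/n]*n D period)))) ⟩
        s (index + D)                                 ≈⟨ period-from-index ⟩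
        s index                                       ∎

      remainder≡0 : D % period ≡ 0
      remainder≡0 with D % period | m%n<n D period | remainder
      ... | zero  | _        | _ = refl
      ... | suc r | r<period | p′ = ⊥-elim (<⇒≱ r<period (s≤s (Least.minimal periodSearch p′)))

  collision : ∀ {a b} → a < b → s a ≈ s b → index + period ≤ b
  collision {a} a<b p with m≤n⇒∃[o]m+o≡n a<b
  ... | o , refl = ≤-trans (+-mono-≤ (index-least q) (∣⇒≤ (period∣ (index-least q) q)))
                           (≤-reflexive (+-suc a o))
    where
      q : s (a + suc o) ≈ s a
      q = ≈-trans (reflexive (cong s (+-suc a o))) (≈-sym p)

  injective : ∀ {a b} → a < index + period → b < index + period → s a ≈ s b → a ≡ b
  injective {a} {b} a< b< p with <-cmp a b
  ... | tri< a<b _ _ = ⊥-elim (<⇒≱ b< (collision a<b p))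
  ... | tri≈ _ a≡b _ = a≡b
  ... | tri> _ _ b<a = ⊥-elim (<⇒≱ a< (collision b<a (≈-sym p)))

  private
    reduce : ∀ k → Σ ℕ λ j → j < index + period × s j ≈ s k
    reduce k with k <? index
    ... | yes k<index = k , ≤-trans k<index (m≤m+n index period) , ≈-refl
    ... | no  k≮index = index + r , +-monoʳ-< index (m%n<n (k ∸ index) period) , (begin
          s (index + r)               ≈⟨ period-* (periodic-from (m≤m+n index r)) q ⟨
          s (index + r + q * period)  ≡⟨ cong s (trans (+-assoc index r _)
                                            (cong (index +_) (sym (m≡m%n+[m/n]*n (k ∸ index) period)))) ⟩
          s (index + (k ∸ index))     ≡⟨ cong s (m+[n∸m]≡n (≮⇒≥ k≮index)) ⟩
          s k                         ∎)
      where
        r q : ℕ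
        r = (k ∸ index) % period
        q = (k ∸ index) / period

  representative : ℕ → Fin (index + period)
  representative k = fromℕ< (proj₁ (proj₂ (reduce k)))

  representative-≈ : ∀ k → s (toℕ (representative k)) ≈ s k
  representative-≈ k = ≈-trans (reflexive (cong s (toℕ-fromℕ< _))) (proj₂ (proj₂ (reduce k)))

∣p∣≡1+∣p-x∣ : ∀ {k} {p : Subset k} {x} → x ∈ p → ∣ p ∣ ≡ suc ∣ p - x ∣
∣p∣≡1+∣p-x∣ {p = inside  ∷ p} here        = cong (suc ∘ ∣_∣) (sym (p─⊥≡p p))
∣p∣≡1+∣p-x∣ {p = outside ∷ p} (there x∈p) = ∣p∣≡1+∣p-x∣ x∈p
∣p∣≡1+∣p-x∣ {p = inside  ∷ p} (there x∈p) = cong suc (∣p∣≡1+∣p-x∣ x∈p)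

x∉p-x : ∀ {k} {p : Subset k} x → x ∉ p - x
x∉p-x {p = _ ∷ _} zero    ()
x∉p-x {p = _ ∷ _} (suc x) (there x∈p-x) = x∉p-x x x∈p-x

∣p∣≡n-of-enumeration : ∀ {k n} {p : Subset k} (h : Fin n → Fin k) → Injective _≡_ _≡_ h →
                       (∀ i → h i ∈ p) → (∀ {x} → x ∈ p → ∃ λ i → h i ≡ x) → ∣ p ∣ ≡ n
∣p∣≡n-of-enumeration {k} {zero} h _ _ onto =
  trans (cong ∣_∣ (Empty-unique λ (_ , x∈p) → case proj₁ (onto x∈p) of λ ())) (∣⊥∣≡0 k)
∣p∣≡n-of-enumeration {n = suc n} {p} h inj into onto =
  trans (∣p∣≡1+∣p-x∣ (into zero))
        (cong suc (∣p∣≡n-of-enumeration (h ∘ suc) (suc-injective ∘ inj) into′ onto′))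
  where
    into′ : ∀ i → h (suc i) ∈ p - h zero
    into′ i = x∈p∧x≢y⇒x∈p-y (into (suc i)) λ eq → case inj eq of λ ()

    onto′ : ∀ {x} → x ∈ p - h zero → ∃ λ i → h (suc i) ≡ x
    onto′ x∈ with onto (p─q⊆p p _ x∈)
    ... | zero  , refl = ⊥-elim (x∉p-x _ x∈)
    ... | suc i , eq   = i , eq

module _ {k : ℕ} (f : Fin k → Fin k) where

  iter⇒Path : ∀ j x → Path f (iter f j x) x j
  iter⇒Path zero    x = here
  iter⇒Path (suc j) x = there (subst (λ r → Path f r (f x) j) (iter-commute f j x) (iter⇒Path j (f x)))

  Path⇒iter : ∀ {r x j} → Path f r x j → iter f j x ≡ r
  Path⇒iter here                         = refl
  Path⇒iter (there {c = x} {k = j} path) = trans (sym (iter-commute f j x)) (Path⇒iter path)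

  Path⇒Conn : ∀ {r x j} → Path f r x j → Conn f r x
  Path⇒Conn here         = conn-refl
  Path⇒Conn (there path) = conn-fwd (Path⇒Conn path)

  source-closed : ∀ {S x} → IsSource f S → x ∈ S → ∀ j → iter f j x ∈ S
  source-closed         _                        x∈S zero    = x∈S
  source-closed {x = x} src@(_ , _ , _ , closed) x∈S (suc j) = closed (iter f j x) (source-closed src x∈S j)

  source⇒periodic : ∀ {S x} → IsSource f S → x ∈ S → ∃ λ j → iter f (suc j) x ≡ x
  source⇒periodic {x = x} (_ , connected , _ , closed) x∈S with connected x (f x) x∈S (closed x x∈S)
  ... | j , path = j , trans (sym (iter-commute f j x)) (Path⇒iter path)

  ring⇒periodic : ∀ {r x} → InRingOf f r x → ∃ λ j → iter f (suc j) r ≡ r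
  ring⇒periodic (_ , src , r∈S , _) = source⇒periodic src r∈S

  sources-≡ : ∀ {S T x} → IsSource f S → IsSource f T → x ∈ S → x ∈ T → S ≡ T
  sources-≡ S-src T-src x∈S x∈T = ⊆-antisym (⊆-via S-src T-src x∈S x∈T) (⊆-via T-src S-src x∈T x∈S)
    where
      ⊆-via : ∀ {S T x} → IsSource f S → IsSource f T → x ∈ S → x ∈ T → S ⊆ T
      ⊆-via {x = x} (_ , connected , _) T-src x∈S x∈T {s} s∈S with connected s x s∈S x∈S
      ... | j , path = subst (_∈ _) (Path⇒iter path) (source-closed T-src x∈T j)

module Orbit {k : ℕ} (f : Fin k → Fin k) (y : Fin k) (B : ℕ) (periodic : iter f (suc B) y ≡ y) where

  private
    visits : ∀ x → Dec (∃ λ (i : Fin (suc B)) → iter f (toℕ i) y ≡ x)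
    visits x = any? λ i → iter f (toℕ i) y ≟ᶠ x

  orbit : Subset k
  orbit = tabulate (does ∘ visits)

  ∈orbit⁻ : ∀ {x} → x ∈ orbit → ∃ λ (i : Fin (suc B)) → iter f (toℕ i) y ≡ x
  ∈orbit⁻ {x} x∈ = witness (visits x) (trans (sym (lookup∘tabulate (does ∘ visits) x)) ([]=⇒lookup x∈))
    where
      witness : ∀ {A : Set} (a? : Dec A) → does a? ≡ true → A
      witness (yes a) _ = a

  iter∈orbit : ∀ j {x} → iter f j y ≡ x → x ∈ orbit
  iter∈orbit j {x} eq =
    lookup⇒[]= x orbit (trans (lookup∘tabulate (does ∘ visits) x) (dec-true (visits x) (i , reduced)))
    where
      i : Fin (suc B)
      i = fromℕ< (m%n<n j (suc B))

      reduced : iter f (toℕ i) y ≡ x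
      reduced = begin
        iter f (toℕ i) y                                   ≡⟨ cong (λ t → iter f t y) (toℕ-fromℕ< (m%n<n j (suc B))) ⟩
        iter f (j % suc B) y                               ≡⟨ cong (iter f (j % suc B))
                                                                (iter-*-fixed f periodic (j / suc B)) ⟨
        iter f (j % suc B) (iter f (j / suc B * suc B) y)  ≡⟨ iter-+ f (j % suc B) _ y ⟨
        iter f (j % suc B + j / suc B * suc B) y           ≡⟨ cong (λ t → iter f t y) (m≡m%n+[m/n]*n j (suc B)) ⟨
        iter f j y                                         ≡⟨ eq ⟩
        x                                                  ∎
        where open ≡-Reasoning

  y∈orbit : y ∈ orbit
  y∈orbit = iter∈orbit 0 refl

  orbit-isSource : IsSource f orbit
  orbit-isSource = (y , y∈orbit) , connected , maximal , closed
    where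
      connected : StronglyConnected f orbit
      connected a b a∈ b∈ with ∈orbit⁻ a∈ | ∈orbit⁻ b∈
      ... | i , refl | j , refl =
        toℕ i + (suc B ∸ toℕ j) , subst (λ r → Path f r _ _) returns (iter⇒Path f _ _)
        where
          returns : iter f (toℕ i + (suc B ∸ toℕ j)) (iter f (toℕ j) y) ≡ iter f (toℕ i) y
          returns = begin
            iter f (toℕ i + (suc B ∸ toℕ j)) (iter f (toℕ j) y)  ≡⟨ iter-+ f (toℕ i + (suc B ∸ toℕ j)) (toℕ j) y ⟨
            iter f (toℕ i + (suc B ∸ toℕ j) + toℕ j) y           ≡⟨ cong (λ t → iter f t y)
                                                                      (trans (+-assoc (toℕ i) _ _)
                                                                         (cong (toℕ i +_) (m∸n+n≡m (<⇒≤ (toℕ<n j))))) ⟩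
            iter f (toℕ i + suc B) y                             ≡⟨ iter-+ f (toℕ i) (suc B) y ⟩
            iter f (toℕ i) (iter f (suc B) y)                    ≡⟨ cong (iter f (toℕ i)) periodic ⟩
            iter f (toℕ i) y                                     ∎
            where open ≡-Reasoning

      maximal : ∀ T → orbit ⊆ T → StronglyConnected f T → T ⊆ orbit
      maximal T orbit⊆T connected {t} t∈T with connected t y t∈T (orbit⊆T y∈orbit)
      ... | j , path = iter∈orbit j (Path⇒iter f path)

      closed : ∀ x → x ∈ orbit → f x ∈ orbit
      closed x x∈ with ∈orbit⁻ x∈
      ... | i , refl = iter∈orbit (suc (toℕ i)) refl

  ∣orbit∣ : (∀ {i j : Fin (suc B)} → iter f (toℕ i) y ≡ iter f (toℕ j) y → i ≡ j) → ∣ orbit ∣ ≡ suc B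
  ∣orbit∣ injective =
    ∣p∣≡n-of-enumeration (λ i → iter f (toℕ i) y) injective (λ i → iter∈orbit (toℕ i) refl) ∈orbit⁻

periodic⇒ring : ∀ {k} (f : Fin k → Fin k) {r x B} → iter f (suc B) r ≡ r → Conn f r x → InRingOf f r x
periodic⇒ring f {r} {B = B} periodic conn = orbit , orbit-isSource , y∈orbit , conn
  where open Orbit f r B periodic

module PeriodicPoint {k : ℕ} (f : Fin k → Fin k) {y : Fin k} {j : ℕ} (y-periodic : iter f (suc j) y ≡ y) where

  open EventuallyPeriodic (≡-decSetoid k) (λ i → iter f i y) (orbit-shift f) {0} {j} y-periodic public

  private
    index≤0 : index ≤ 0
    index≤0 = index-least {e = j} y-periodic

  period-fixes : iter f period y ≡ y
  period-fixes = periodic-from index≤0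

  fixed⇒period∣ : ∀ {D} → iter f D y ≡ y → period ∣ D
  fixed⇒period∣ = period∣ index≤0

  period∣⇒fixed : ∀ {D} → period ∣ D → iter f D y ≡ y
  period∣⇒fixed (divides q refl) = iter-*-fixed f period-fixes q

  open Orbit f y (pred period) period-fixes public

  ∣orbit∣≡period : ∣ orbit ∣ ≡ period
  ∣orbit∣≡period = ∣orbit∣ λ {i} {i′} eq → toℕ-injective (injective (bound i) (bound i′) eq)
    where
      bound : (i : Fin period) → toℕ i < index + period
      bound i = ≤-trans (toℕ<n i) (m≤n+m period index)

  ∣source∣≡period : ∀ {S} → IsSource f S → y ∈ S → ∣ S ∣ ≡ period
  ∣source∣≡period src y∈S = trans (cong ∣_∣ (sources-≡ f src orbit-isSource y∈S y∈orbit)) ∣orbit∣≡period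

orbit-repeats : ∀ {k} (f : Fin k → Fin k) x → ∃ λ e → suc e ≤ k × iter f (k + suc e) x ≡ iter f k x
orbit-repeats {k} f x with pigeonhole (n<1+n k) (λ (i : Fin (suc k)) → iter f (toℕ i) x)
... | i , j , i<j , same with m≤n⇒∃[o]m+o≡n i<j
... | o , i+o≡j =
  o , ≤-trans (s≤s (m≤n+m o (toℕ i))) (≤-trans (≤-reflexive i+o≡j) (s≤s⁻¹ (toℕ<n j)))
    , OrbitOf.period-≤ f x repeats-at-i (s≤s⁻¹ (toℕ<n i))
  where
    repeats-at-i : iter f (toℕ i + suc o) x ≡ iter f (toℕ i) x
    repeats-at-i = trans (cong (λ t → iter f t x) (trans (+-suc (toℕ i) o) i+o≡j)) (sym same)

module Powers {n : ℕ} (σ : Fin n → Fin n) where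

  private
    powers-shift : ∀ k {a b} → iter σ a ≗ iter σ b → iter σ (k + a) ≗ iter σ (k + b)
    powers-shift k eq x = orbit-shift σ k (eq x)

    -- Each orbit repeats from step n on with a period e + 1 ≤ n, which divides n!.
    repeats : iter σ (n + suc (pred (n !))) ≗ iter σ n
    repeats x with orbit-repeats σ x
    ... | e , e<n , repeats-at-n with ∣-trans (m∣m*n (e !)) (m≤n⇒m!∣n! e<n)
    ... | divides q n!≡q*[1+e] = begin
      iter σ (n + suc (pred (n !))) x  ≡⟨ cong (λ t → iter σ (n + t) x)
                                             (trans (suc-pred (n !) {{n !≢0}}) n!≡q*[1+e]) ⟩
      iter σ (n + q * suc e) x         ≡⟨ OrbitOf.period-* σ x {n} repeats-at-n q ⟩
      iter σ n x                       ∎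
      where open ≡-Reasoning

  open EventuallyPeriodic (Pointwise.decSetoid (≡-decSetoid n) n) (iter σ) powers-shift
                          {n} {pred (n !)} repeats public

  periodic⇒fixed : ∀ {y j} → iter σ (suc j) y ≡ y → iter σ period y ≡ y
  periodic⇒fixed {y} {j} y-periodic = begin
    iter σ period y                           ≡⟨ cong (iter σ period) (iter-*-fixed σ y-periodic index) ⟨
    iter σ period (iter σ (index * suc j) y)  ≡⟨ iter-+′ σ (index * suc j) period y ⟨
    iter σ (index * suc j + period) y         ≡⟨ periodic-from (m≤m*n index (suc j)) y ⟩
    iter σ (index * suc j) y                  ≡⟨ iter-*-fixed σ y-periodic index ⟩
    y                                         ∎
    where open ≡-Reasoning

  ring⇒fixed : ∀ {r x} → InRingOf σ r x → iter σ period r ≡ r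
  ring⇒fixed ring = let (j , r-periodic) = ring⇒periodic σ ring in periodic⇒fixed {j = j} r-periodic

  eventually-periodic : ∀ x → iter σ period (iter σ index x) ≡ iter σ index x
  eventually-periodic x = trans (sym (iter-+′ σ index period x)) (period-at-index x)

  reaches-ring : ∀ x → InRingOf σ (iter σ index x) x
  reaches-ring x = periodic⇒ring σ {B = pred period} (eventually-periodic x) (Path⇒Conn σ (iter⇒Path σ index x))

  ∣source∣∣period : ∀ {S} → IsSource σ S → ∣ S ∣ ∣ period
  ∣source∣∣period {S} src@((x , x∈S) , _) = ∣S∣∣period (source⇒periodic σ src x∈S)
    where
      ∣S∣∣period : (∃ λ j → iter σ (suc j) x ≡ x) → ∣ S ∣ ∣ period
      ∣S∣∣period (j , x-periodic) = subst (_∣ period) (sym (X.∣source∣≡period src x∈S))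
                                          (X.fixed⇒period∣ (periodic⇒fixed {j = j} x-periodic))
        where module X = PeriodicPoint σ {j = j} x-periodic

  period∣common-multiple : ∀ {l} → (∀ S → IsSource σ S → ∣ S ∣ ∣ l) → period ∣ l
  period∣common-multiple {l} ∣S∣∣l = period∣ ≤-refl λ x →
    trans (iter-+′ σ index l x) (fixed-by-l {j = pred period} (eventually-periodic x))
    where
      fixed-by-l : ∀ {y j} → iter σ (suc j) y ≡ y → iter σ l y ≡ y
      fixed-by-l {j = j} y-periodic =
        Y.period∣⇒fixed (subst (_∣ l) Y.∣orbit∣≡period (∣S∣∣l Y.orbit Y.orbit-isSource))
        where module Y = PeriodicPoint σ {j = j} y-periodic

  lcm≡period : ∀ {l} → IsLcmOfRingSizes σ l → l ≡ period
  lcm≡period (common , least′) =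
    ∣-antisym (least′ period λ _ → ∣source∣∣period) (period∣common-multiple common)

  ring-distance : ∀ x → Σ ℕ λ d → MinDist σ x d × iter σ period (iter σ d x) ≡ iter σ d x
  ring-distance x = d , ((iter σ d x , ring , iter⇒Path σ d x) , nearest) , d-fixed
    where
      search : Least λ j → iter σ period (iter σ j x) ≡ iter σ j x
      search = least (λ j → iter σ period (iter σ j x) ≟ᶠ iter σ j x) {w = index} (eventually-periodic x)

      open Least search renaming (value to d; holds to d-fixed)

      ring : InRingOf σ (iter σ d x) x
      ring = periodic⇒ring σ {B = pred period} d-fixed (Path⇒Conn σ (iter⇒Path σ d x))

      nearest : ∀ r j → InRingOf σ r x → Path σ r x j → d ≤ j
      nearest r j r-ring path = minimal (subst (λ r → iter σ period r ≡ r) (sym (Path⇒iter σ path)) (ring⇒fixed r-ring))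

  depth≡index : ∀ {p} → HasDepth σ p → p ≡ index
  depth≡index {p} (bounded , least′) =
    ≤-antisym (least′ index index-bounds) (index-least {e = pred period} fixed-from-p)
    where
      index-bounds : ∀ x d → MinDist σ x d → d ≤ index
      index-bounds x d (_ , nearest) = nearest (iter σ index x) index (reaches-ring x) (iter⇒Path σ index x)

      fixed-from-p : iter σ (p + period) ≗ iter σ p
      fixed-from-p x = let (d , dist , d-fixed) = ring-distance x in
        OrbitOf.period-≤ σ x (trans (iter-+′ σ d period x) d-fixed) (bounded x d dist)

  canonical : IsFundamentalNetwork σ (index + period) (λ i → representative (suc (toℕ i)))
  canonical = (λ i → iter σ (toℕ i))
            , (λ i → toℕ i , λ _ → refl)
            , (λ k → representative k , representative-≈ k)
            , (λ i j eq → toℕ-injective (injective (toℕ<n i) (toℕ<n j) eq))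
            , (λ i → representative-≈ (suc (toℕ i)))

  module FundamentalNetwork {m : ℕ} {τ : Fin m → Fin m} (network : IsFundamentalNetwork σ m τ) where

    private
      e : Fin m → Fin n → Fin n
      e = proj₁ network

      presented : ∀ i → ∃ λ k → e i ≗ iter σ k
      presented = proj₁ (proj₂ network)

      presents : ∀ k → ∃ λ i → e i ≗ iter σ k
      presents = proj₁ (proj₂ (proj₂ network))

      e-injective : ∀ i j → e i ≗ e j → i ≡ j
      e-injective = proj₁ (proj₂ (proj₂ (proj₂ network)))

      e-τ : ∀ i → e (τ i) ≗ σ ∘ e i
      e-τ = proj₂ (proj₂ (proj₂ (proj₂ network)))

    power : ℕ → Fin m
    power k = proj₁ (presents k)

    e∘power : ∀ k → e (power k) ≗ iter σ k
    e∘power k = proj₂ (presents k)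

    power≡⇒≗ : ∀ {a b} → power a ≡ power b → iter σ a ≗ iter σ b
    power≡⇒≗ {a} {b} eq x = trans (sym (e∘power a x)) (trans (cong (λ i → e i x) eq) (e∘power b x))

    ≗⇒power≡ : ∀ {a b} → iter σ a ≗ iter σ b → power a ≡ power b
    ≗⇒power≡ {a} {b} eq = e-injective (power a) (power b) λ x → trans (e∘power a x) (trans (eq x) (sym (e∘power b x)))

    power-surjective : ∀ i → ∃ λ k → power k ≡ i
    power-surjective i = let (k , eᵢ≗σᵏ) = presented i in
      k , e-injective (power k) i λ x → trans (e∘power k x) (sym (eᵢ≗σᵏ x))

    τ-power : ∀ k → τ (power k) ≡ power (suc k)
    τ-power k = e-injective (τ (power k)) (power (suc k)) λ x →
      trans (e-τ (power k) x) (trans (cong σ (e∘power k x)) (sym (e∘power (suc k) x)))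

    τ-iter-power : ∀ j k → iter τ j (power k) ≡ power (k + j)
    τ-iter-power zero    k = cong power (sym (+-identityʳ k))
    τ-iter-power (suc j) k =
      trans (cong τ (τ-iter-power j k)) (trans (τ-power (k + j)) (cong power (sym (+-suc k j))))

    size : m ≡ index + period
    size = ≤-antisym (injective⇒≤ {f = compress} compress-injective)
                     (injective⇒≤ {f = power ∘ toℕ} expand-injective)
      where
        expand-injective : ∀ {a b : Fin (index + period)} → power (toℕ a) ≡ power (toℕ b) → a ≡ b
        expand-injective {a} {b} eq = toℕ-injective (injective (toℕ<n a) (toℕ<n b) (power≡⇒≗ eq))

        compress : Fin m → Fin (index + period)
        compress i = representative (proj₁ (power-surjective i))

        expand-compress : ∀ i → power (toℕ (compress i)) ≡ i
        expand-compress i =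
          trans (≗⇒power≡ (representative-≈ (proj₁ (power-surjective i)))) (proj₂ (power-surjective i))

        compress-injective : ∀ {i j} → compress i ≡ compress j → i ≡ j
        compress-injective {i} {j} eq =
          trans (sym (expand-compress i)) (trans (cong (power ∘ toℕ) eq) (expand-compress j))

    cycle-periodic : iter τ period (power index) ≡ power index
    cycle-periodic = trans (τ-iter-power period index) (≗⇒power≡ period-at-index)

    open Orbit τ (power index) (pred period) cycle-periodic renaming (orbit to cycle)

    τ-periodic⇒index≤ : ∀ {j k} → iter τ (suc j) (power k) ≡ power k → index ≤ k
    τ-periodic⇒index≤ {j} {k} periodic =
      index-least {e = j} (power≡⇒≗ (trans (sym (τ-iter-power (suc j) k)) periodic))

    ∣cycle∣ : ∣ cycle ∣ ≡ period
    ∣cycle∣ = ∣orbit∣ λ {i} {j} eq → toℕ-injective (+-cancelˡ-≡ index _ _ (injective (bound i) (bound j)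
      (power≡⇒≗ (trans (sym (τ-iter-power (toℕ i) index)) (trans eq (τ-iter-power (toℕ j) index))))))
      where
        bound : (i : Fin period) → index + toℕ i < index + period
        bound i = +-monoʳ-< index (toℕ<n i)

    unique-source : ∀ T → IsSource τ T → T ≡ cycle
    unique-source T src@((t , t∈T) , _) = on-cycle (source⇒periodic τ src t∈T) (power-surjective t)
      where
        on-cycle : (∃ λ j → iter τ (suc j) t ≡ t) → (∃ λ k → power k ≡ t) → T ≡ cycle
        on-cycle (j , t-periodic) (k , refl) =
          sources-≡ τ src orbit-isSource t∈T (iter∈orbit (k ∸ index) reached)
          where
            reached : iter τ (k ∸ index) (power index) ≡ power k
            reached = trans (τ-iter-power (k ∸ index) index)
                            (cong power (m+[n∸m]≡n (τ-periodic⇒index≤ {j = j} t-periodic)))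

    reaches-cycle : ∀ i → InRingOf τ (iter τ index i) i
    reaches-cycle i = let (k , powerₖ≡i) = power-surjective i in
      subst (λ i → InRingOf τ (iter τ index i) i) powerₖ≡i
        (cycle , orbit-isSource , iter∈orbit k (cycle-shift k) , Path⇒Conn τ (iter⇒Path τ index (power k)))
      where
        cycle-shift : ∀ k → iter τ k (power index) ≡ iter τ index (power k)
        cycle-shift k =
          trans (τ-iter-power k index) (trans (cong power (+-comm index k)) (sym (τ-iter-power index k)))

    depth : HasDepth τ index
    depth = (λ i d (_ , nearest) → nearest (iter τ index i) index (reaches-cycle i) (iter⇒Path τ index i))
          , (λ q bounded → bounded (power 0) index
                             ((iter τ index (power 0) , reaches-cycle (power 0) , iter⇒Path τ index (power 0)) , far))
      where
        far : ∀ r k → InRingOf τ r (power 0) → Path τ r (power 0) k → index ≤ k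
        far r k ring path = let (j , r-periodic) = ring⇒periodic τ ring in
          τ-periodic⇒index≤ {j = j}
            (subst (λ r → iter τ (suc j) r ≡ r) (trans (sym (Path⇒iter τ path)) (τ-iter-power k 0)) r-periodic)

    isLoopChain : IsLoopChain τ period index
    isLoopChain = trans size (+-comm index period) , (cycle , orbit-isSource , ∣cycle∣ , unique-source) , depth

mainTheorem19 : (n : ℕ) (σ : Fin n → Fin n) (l p : ℕ) →
    IsLcmOfRingSizes σ l → HasDepth σ p →
    Σ ℕ (λ m → Σ (Fin m → Fin m) λ τ → IsFundamentalNetwork σ m τ)
    × ((m : ℕ) (τ : Fin m → Fin m) → IsFundamentalNetwork σ m τ → IsLoopChain τ l p)
mainTheorem19 n σ l p lcm depth =
    (index + period , _ , canonical)
  , λ m τ network → subst₂ (IsLoopChain τ) (sym (lcm≡period lcm)) (sym (depth≡index depth))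
                                          (FundamentalNetwork.isLoopChain network)
  where open Powers σ
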